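{- Let $G=(V,E)$ be a graph with node weights $w:V\to\mathbb{N}$ and let $T\ge1$. Consider independent sets $I_1,\dots,I_T$ and weight functions $w_1,\dots,w_{T+1}$, $w_1',\dots,w_T'$ constructed as follows: $w_1=w$; $I_1$ is an arbitrary independent set of $G$; for each $i\in\{1,\dots,T\}$, $w_{i+1}(u)=\max\{0,\,w_i(u)-\sum_{v\in N^+(u)\cap I_i}w_i(v)\}$ and $w_i'(u)=w_i(u)-w_{i+1}(u)$ for all $u\in V$; for $i>1$, $I_i$ is an arbitrary independent set of the subgraph of $G$ induced by the nodes $v$ with $w_i(v)>0$. Define $I$ by starting from $I=\emptyset$ and, for $j=T,T-1,\dots,1$ in this order, setting $I_j':=I_j\setminus N^+(I)$ and $I:=I\cup I_j'$. Then \[w(I)\ \ge\ \sum_{i=1}^T w_i(I_i)\ =\ \sum_{i=1}^T w_i'(I_i).\]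
   Context: $N^+(v)=\{v\}\cup N(v)$; for a set $S$, $N^+(S)=\bigcup_{v\in S}N^+(v)$; for a weight function $f$ and set $S$, $f(S)=\sum_{v\in S}f(v)$. -}

module Defs where

open import Data.Nat using (ℕ; zero; suc; _+_; _∸_; _≤_; _<_)
open import Data.Bool using (Bool; true; false; _∧_; _∨_; not; if_then_else_)
open import Data.Fin using (Fin; zero; suc; _≟_)
open import Data.List using (List; []; _∷_; downFrom)
open import Data.Product using (_×_)
open import Relation.Nullary.Decidable using (⌊_⌋)
open import Relation.Binary.PropositionalEquality using (_≡_)

Subset : ℕ → Set
Subset n = Fin n → Bool

Weight : ℕ → Set
Weight n = Fin n → ℕ

Adjacency : ℕ → Set
Adjacency n = Fin n → Fin n → Bool

IsSimpleGraph : ∀ {n} → Adjacency n → Set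
IsSimpleGraph {n} adj =
  (∀ (u v : Fin n) → adj u v ≡ adj v u) × (∀ (u : Fin n) → adj u u ≡ false)

IsIndependent : ∀ {n} → Adjacency n → Subset n → Set
IsIndependent {n} adj S =
  ∀ (u v : Fin n) → S u ≡ true → S v ≡ true → adj u v ≡ false

sumFin : ∀ {n} → (Fin n → ℕ) → ℕ
sumFin {zero} f = 0
sumFin {suc n} f = f zero + sumFin (λ i → f (suc i))

anyFin : ∀ {n} → (Fin n → Bool) → Bool
anyFin {zero} p = false
anyFin {suc n} p = p zero ∨ anyFin (λ i → p (suc i))

weightOf : ∀ {n} → Weight n → Subset n → ℕ
weightOf f S = sumFin (λ v → if S v then f v else 0)

inNplus : ∀ {n} → Adjacency n → Fin n → Fin n → Bool
inNplus adj u v = ⌊ u ≟ v ⌋ ∨ adj u v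

NplusSet : ∀ {n} → Adjacency n → Subset n → Subset n
NplusSet adj S u = anyFin (λ v → S v ∧ inNplus adj v u)

-- One reduction step:
-- w'(u) = max{0, w(u) − Σ_{v ∈ N⁺(u) ∩ I} w(v)}   (ℕ-monus = max{0, ·})
step : ∀ {n} → Adjacency n → Weight n → Subset n → Weight n
step adj w I u = w u ∸ weightOf w (λ v → inNplus adj u v ∧ I v)

-- Weight sequence, 0-based: wts adj w I i = w_{i+1}, where I i = I_{i+1}.
-- So wts … 0 = w_1 = w and wts … (suc i) = w_{i+2} is computed from w_{i+1}, I_{i+1}.
wts : ∀ {n} → Adjacency n → Weight n → (ℕ → Subset n) → ℕ → Weight n
wts adj w I zero = w
wts adj w I (suc i) = step adj (wts adj w I i) (I i)

wts' : ∀ {n} → Adjacency n → Weight n → (ℕ → Subset n) → ℕ → Weight n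
wts' adj w I i u = wts adj w I i u ∸ wts adj w I (suc i) u

greedy : ∀ {n} → Adjacency n → (ℕ → Subset n) → Subset n → List ℕ → Subset n
greedy adj I S [] = S
greedy adj I S (j ∷ js) =
  greedy adj I (λ u → S u ∨ (I j u ∧ not (NplusSet adj S u))) js

emptySet : ∀ {n} → Subset n
emptySet _ = false

-- Final set I: start from ∅, process j = T, T−1, …, 1
-- (0-based: downFrom T = T−1, …, 0).
finalSet : ∀ {n} → Adjacency n → (ℕ → Subset n) → ℕ → Subset n
finalSet adj I T = greedy adj I emptySet (downFrom T)

sumUpTo : ℕ → (ℕ → ℕ) → ℕ
sumUpTo zero f = 0
sumUpTo (suc T) f = sumUpTo T f + f T

{-# OPTIONS --safe #-}
-- Writing w'_i = w_i − w_{i+1}, the weights telescope: w = Σ_{i ≤ T} w'_i + w_{T+1}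
-- pointwise, so Σ_i w'_i(I) ≤ w(I) and it suffices to show w_i(I_i) ≤ w'_i(I) for each i.
-- Inside an independent set a vertex v sees only itself in N⁺(v) ∩ I_i, so w'_i = w_i on
-- I_i; this is also the claimed equality.  When the backward greedy pass reaches I_i it
-- has already chosen a set S of vertices from later sets I_k, whose weights w_k, and hence
-- w_{i+1}, are still positive; so the reduction at u ∈ S was not truncated at 0, i.e.
-- w'_i(u) = w_i(N⁺(u) ∩ I_i), and a union bound gives w_i(I_i ∩ N⁺(S)) ≤ w'_i(S).  The
-- remainder I_i ∖ N⁺(S), on which w_i = w'_i, is added to I and is disjoint from S.
module Submission where

open import Defs
open import Data.Nat using (ℕ; zero; suc; _+_; _∸_; _≤_; _<_; _≥_; _≤′_; ≤′-refl; ≤′-step; z≤n; s≤s)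
open import Data.Nat.Properties hiding (_≟_)
open import Algebra.Properties.CommutativeSemigroup +-commutativeSemigroup using (interchange)
open import Data.Fin using (Fin; zero; suc; _≟_)
open import Data.Bool using (Bool; true; false; _∧_; _∨_; not; if_then_else_)
open import Data.Bool.Properties using (∧-zeroʳ; ∧-conicalˡ; ∧-conicalʳ)
open import Data.List using ([]; _∷_; downFrom)
open import Data.Product using (_×_; _,_; ∃-syntax)
open import Data.Sum using (inj₁; inj₂)
open import Relation.Nullary using (yes; no)
open import Relation.Nullary.Decidable using (⌊_⌋; ⌊⌋-map′)
open import Relation.Binary.PropositionalEquality

private variable
  n T i : ℕ

sumFin-zero : sumFin {n} (λ _ → 0) ≡ 0
sumFin-zero {zero} = refl
sumFin-zero {suc n} = sumFin-zero {n}

sumFin-cong : {f g : Fin n → ℕ} → (∀ u → f u ≡ g u) → sumFin f ≡ sumFin g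
sumFin-cong {zero} f≗g = refl
sumFin-cong {suc n} f≗g = cong₂ _+_ (f≗g zero) (sumFin-cong (λ u → f≗g (suc u)))

sumFin-mono : {f g : Fin n → ℕ} → (∀ u → f u ≤ g u) → sumFin f ≤ sumFin g
sumFin-mono {zero} f≤g = z≤n
sumFin-mono {suc n} f≤g = +-mono-≤ (f≤g zero) (sumFin-mono (λ u → f≤g (suc u)))

sumFin-+ : (f g : Fin n → ℕ) → sumFin (λ u → f u + g u) ≡ sumFin f + sumFin g
sumFin-+ {zero} f g = refl
sumFin-+ {suc n} f g =
  trans (cong (f zero + g zero +_) (sumFin-+ (λ u → f (suc u)) (λ u → g (suc u))))
        (interchange (f zero) (g zero) _ _)

sumFin-comm : ∀ {m} (h : Fin m → Fin n → ℕ) →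
  sumFin (λ u → sumFin (h u)) ≡ sumFin (λ v → sumFin (λ u → h u v))
sumFin-comm {n} {m = zero} h = sym (sumFin-zero {n})
sumFin-comm {m = suc m} h =
  trans (cong (sumFin (h zero) +_) (sumFin-comm (λ u → h (suc u))))
        (sym (sumFin-+ (h zero) (λ v → sumFin (λ u → h (suc u) v))))

term≤sumFin : (f : Fin n → ℕ) (v : Fin n) → f v ≤ sumFin f
term≤sumFin f zero = m≤m+n _ _
term≤sumFin f (suc v) = ≤-trans (term≤sumFin (λ u → f (suc u)) v) (m≤n+m _ _)

sumUpTo-cong : ∀ T {f g : ℕ → ℕ} → (∀ i → i < T → f i ≡ g i) → sumUpTo T f ≡ sumUpTo T g
sumUpTo-cong zero f≗g = refl
sumUpTo-cong (suc T) f≗g =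
  cong₂ _+_ (sumUpTo-cong T (λ i i<T → f≗g i (m<n⇒m<1+n i<T))) (f≗g T ≤-refl)

sumUpTo-mono : ∀ T {f g : ℕ → ℕ} → (∀ i → i < T → f i ≤ g i) → sumUpTo T f ≤ sumUpTo T g
sumUpTo-mono zero f≤g = z≤n
sumUpTo-mono (suc T) f≤g =
  +-mono-≤ (sumUpTo-mono T (λ i i<T → f≤g i (m<n⇒m<1+n i<T))) (f≤g T ≤-refl)

infixr 7 _∩_ _∖_
infixr 6 _∪_
infix 4 _⊆_

_∩_ _∪_ _∖_ : Subset n → Subset n → Subset n
(A ∩ B) u = A u ∧ B u
(A ∪ B) u = A u ∨ B u
(A ∖ B) u = A u ∧ not (B u)

_⊆_ : Subset n → Subset n → Set
A ⊆ B = ∀ u → A u ≡ true → B u ≡ true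

if-true : ∀ {b} {x : ℕ} → b ≡ true → (if b then x else 0) ≡ x
if-true refl = refl

weightOf-congˡ : (f g : Weight n) (S : Subset n) →
  (∀ u → S u ≡ true → f u ≡ g u) → weightOf f S ≡ weightOf g S
weightOf-congˡ f g S f≗g = sumFin-cong pointwise
  where
  pointwise : ∀ u → (if S u then f u else 0) ≡ (if S u then g u else 0)
  pointwise u with S u in Su
  ... | true = f≗g u Su
  ... | false = refl

weightOf-congʳ : (f : Weight n) {A B : Subset n} → (∀ u → A u ≡ B u) →
  weightOf f A ≡ weightOf f B
weightOf-congʳ f A≗B = sumFin-cong (λ u → cong (if_then f u else 0) (A≗B u))

weightOf-zero : (S : Subset n) → weightOf (λ _ → 0) S ≡ 0
weightOf-zero {n} S = trans (sumFin-cong pointwise) (sumFin-zero {n})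
  where
  pointwise : ∀ u → (if S u then 0 else 0) ≡ 0
  pointwise u with S u
  ... | true = refl
  ... | false = refl

weightOf-+ : (f g : Weight n) (S : Subset n) →
  weightOf (λ u → f u + g u) S ≡ weightOf f S + weightOf g S
weightOf-+ {n} f g S = trans (sumFin-cong pointwise) (sumFin-+ {n} _ _)
  where
  pointwise : ∀ u →
    (if S u then f u + g u else 0) ≡ (if S u then f u else 0) + (if S u then g u else 0)
  pointwise u with S u
  ... | true = refl
  ... | false = refl

weightOf-sumUpTo : ∀ T (f : ℕ → Weight n) (S : Subset n) →
  sumUpTo T (λ i → weightOf (f i) S) ≡ weightOf (λ u → sumUpTo T (λ i → f i u)) S
weightOf-sumUpTo zero f S = sym (weightOf-zero S)
weightOf-sumUpTo (suc T) f S =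
  trans (cong (_+ weightOf (f T) S) (weightOf-sumUpTo T f S))
        (sym (weightOf-+ (λ u → sumUpTo T (λ i → f i u)) (f T) S))

weightOf-monoˡ : (f g : Weight n) (S : Subset n) → (∀ u → f u ≤ g u) →
  weightOf f S ≤ weightOf g S
weightOf-monoˡ f g S f≤g = sumFin-mono pointwise
  where
  pointwise : ∀ u → (if S u then f u else 0) ≤ (if S u then g u else 0)
  pointwise u with S u
  ... | true = f≤g u
  ... | false = z≤n

weightOf-monoʳ : (f : Weight n) {A B : Subset n} → A ⊆ B → weightOf f A ≤ weightOf f B
weightOf-monoʳ f {A} {B} A⊆B = sumFin-mono pointwise
  where
  pointwise : ∀ u → (if A u then f u else 0) ≤ (if B u then f u else 0)
  pointwise u with A u in Au
  ... | true rewrite A⊆B u Au = ≤-refl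
  ... | false = z≤n

weightOf-split : (f : Weight n) (A B : Subset n) →
  weightOf f A ≡ weightOf f (A ∩ B) + weightOf f (A ∖ B)
weightOf-split {n} f A B = trans (sumFin-cong pointwise) (sumFin-+ {n} _ _)
  where
  pointwise : ∀ u →
    (if A u then f u else 0) ≡ (if A u ∧ B u then f u else 0) + (if A u ∧ not (B u) then f u else 0)
  pointwise u with A u | B u
  ... | true | true = sym (+-identityʳ (f u))
  ... | true | false = refl
  ... | false | _ = refl

weightOf-∪ : (f : Weight n) (A B : Subset n) → (∀ u → A u ≡ true → B u ≡ false) →
  weightOf f (A ∪ B) ≡ weightOf f A + weightOf f B
weightOf-∪ {n} f A B disjoint = trans (sumFin-cong pointwise) (sumFin-+ {n} _ _)
  where
  pointwise : ∀ u →
    (if A u ∨ B u then f u else 0) ≡ (if A u then f u else 0) + (if B u then f u else 0)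
  pointwise u with A u in Au
  ... | true rewrite disjoint u Au = sym (+-identityʳ (f u))
  ... | false = refl

weightOf-singleton : (f : Weight n) (v : Fin n) → weightOf f (λ u → ⌊ v ≟ u ⌋) ≡ f v
weightOf-singleton {suc n} f zero =
  trans (cong (f zero +_) (sumFin-zero {n})) (+-identityʳ (f zero))
weightOf-singleton f (suc v) =
  trans (sumFin-cong (λ u → cong (if_then f (suc u) else 0) (⌊⌋-map′ _ _ (v ≟ u))))
        (weightOf-singleton (λ u → f (suc u)) v)

anyFin-intro : {p : Fin n → Bool} (u : Fin n) → p u ≡ true → anyFin p ≡ true
anyFin-intro zero pu rewrite pu = refl
anyFin-intro {p = p} (suc u) pu with p zero
... | true = refl
... | false = anyFin-intro u pu

anyFin-witness : (p : Fin n → Bool) → anyFin p ≡ true → ∃[ u ] p u ≡ true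
anyFin-witness {suc n} p any with p zero in p0
... | true = zero , p0
... | false with anyFin-witness (λ u → p (suc u)) any
...   | u , pu = suc u , pu

⌊≟⌋-refl : (v : Fin n) → ⌊ v ≟ v ⌋ ≡ true
⌊≟⌋-refl zero = refl
⌊≟⌋-refl (suc v) = trans (⌊⌋-map′ _ _ (v ≟ v)) (⌊≟⌋-refl v)

module Neighbourhood (adj : Adjacency n) where

  N⁺ : Subset n → Subset n
  N⁺ = NplusSet adj

  ⊆-N⁺ : (S : Subset n) → S ⊆ N⁺ S
  ⊆-N⁺ S u Su = anyFin-intro u (cong₂ _∧_ Su (cong (_∨ adj u u) (⌊≟⌋-refl u)))

  N⁺-witness : (S : Subset n) (v : Fin n) → N⁺ S v ≡ true →
    ∃[ u ] S u ≡ true × inNplus adj u v ≡ true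
  N⁺-witness S v v∈N⁺S with anyFin-witness _ v∈N⁺S
  ... | u , Su∧uv = u , ∧-conicalˡ _ _ Su∧uv , ∧-conicalʳ _ _ Su∧uv

  weightOf-∩-N⁺ : (f : Weight n) (A S : Subset n) →
    weightOf f (A ∩ N⁺ S) ≤ weightOf (λ u → weightOf f (inNplus adj u ∩ A)) S
  weightOf-∩-N⁺ f A S = begin
    weightOf f (A ∩ N⁺ S)                               ≤⟨ sumFin-mono covered ⟩
    sumFin (λ v → sumFin (λ u → if S u ∧ (inNplus adj u v ∧ A v) then f v else 0))
                                                        ≡⟨ sumFin-comm {n} {n} _ ⟨
    sumFin (λ u → weightOf f (λ v → S u ∧ (inNplus adj u ∩ A) v))
                                                        ≡⟨ sumFin-cong (λ u → restrict (S u) _) ⟨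
    weightOf (λ u → weightOf f (inNplus adj u ∩ A)) S ∎
    where
    open ≤-Reasoning
    covered : ∀ v → (if A v ∧ N⁺ S v then f v else 0) ≤
                    sumFin (λ u → if S u ∧ (inNplus adj u v ∧ A v) then f v else 0)
    covered v with A v | N⁺ S v in v∈N⁺S
    ... | false | _ = z≤n
    ... | true | false = z≤n
    ... | true | true with N⁺-witness S v v∈N⁺S
    ...   | u , Su , uv = subst (_≤ sumFin g) (if-true (cong₂ _∧_ Su (cong (_∧ true) uv)))
                                (term≤sumFin g u)
      where
      g : Fin n → ℕ
      g u = if S u ∧ (inNplus adj u v ∧ true) then f v else 0
    restrict : (b : Bool) (B : Subset n) →
      (if b then weightOf f B else 0) ≡ weightOf f (λ v → b ∧ B v)
    restrict true B = refl
    restrict false B = sym (sumFin-zero {n})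

  N⁺-∩-independent : {J : Subset n} → IsIndependent adj J → {v : Fin n} → J v ≡ true →
    ∀ u → (inNplus adj v ∩ J) u ≡ ⌊ v ≟ u ⌋
  N⁺-∩-independent {J} indep {v} Jv u with v ≟ u
  ... | yes refl = Jv
  ... | no _ with J u in Ju
  ...   | true = cong (_∧ true) (indep v u Jv Ju)
  ...   | false = ∧-zeroʳ (adj v u)

  weightOf-N⁺-∩-independent : (f : Weight n) {J : Subset n} → IsIndependent adj J →
    {v : Fin n} → J v ≡ true → weightOf f (inNplus adj v ∩ J) ≡ f v
  weightOf-N⁺-∩-independent f indep Jv =
    trans (weightOf-congʳ f (N⁺-∩-independent indep Jv)) (weightOf-singleton f _)

module WeightSequence (adj : Adjacency n) (w : Weight n) (I : ℕ → Subset n) where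

  open Neighbourhood adj

  W W' : ℕ → Weight n
  W = wts adj w I
  W' = wts' adj w I

  removed : ℕ → Weight n
  removed i u = weightOf (W i) (inNplus adj u ∩ I i)

  wts-antitone : ∀ {i k} → i ≤′ k → ∀ u → W k u ≤ W i u
  wts-antitone ≤′-refl u = ≤-refl
  wts-antitone {k = suc k} (≤′-step i≤k) u =
    ≤-trans (m∸n≤m (W k u) (removed k u)) (wts-antitone i≤k u)

  wts-telescope : ∀ T u → w u ≡ sumUpTo T (λ i → W' i u) + W T u
  wts-telescope zero u = refl
  wts-telescope (suc T) u = begin
    w u                                 ≡⟨ wts-telescope T u ⟩
    Σ + W T u                           ≡⟨ cong (Σ +_) (m∸n+n≡m (m∸n≤m (W T u) (removed T u))) ⟨
    Σ + (W' T u + W (suc T) u)          ≡⟨ +-assoc Σ (W' T u) (W (suc T) u) ⟨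
    Σ + W' T u + W (suc T) u            ∎
    where
    open ≡-Reasoning
    Σ : ℕ
    Σ = sumUpTo T (λ i → W' i u)

  sumUpTo-weightOf-wts'≤ : ∀ T (F : Subset n) → sumUpTo T (λ i → weightOf (W' i) F) ≤ weightOf w F
  sumUpTo-weightOf-wts'≤ T F =
    ≤-trans (≤-reflexive (weightOf-sumUpTo T W' F))
            (weightOf-monoˡ _ w F (λ u →
               subst (sumUpTo T (λ i → W' i u) ≤_) (sym (wts-telescope T u)) (m≤m+n _ _)))

  wts'-untruncated : ∀ i u → 0 < W (suc i) u → W' i u ≡ removed i u
  wts'-untruncated i u positive =
    m∸[m∸n]≡n (<⇒≤ (m∸n≢0⇒n<m {W i u} (n>0⇒n≢0 positive)))

  wts'-independent : ∀ {i} → IsIndependent adj (I i) → ∀ v → I i v ≡ true → W' i v ≡ W i v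
  wts'-independent {i} indep v Iv = begin
    W i v ∸ (W i v ∸ removed i v)  ≡⟨ cong (λ r → W i v ∸ (W i v ∸ r))
                                            (weightOf-N⁺-∩-independent (W i) indep Iv) ⟩
    W i v ∸ (W i v ∸ W i v)        ≡⟨ cong (W i v ∸_) (n∸n≡0 (W i v)) ⟩
    W i v                          ∎
    where open ≡-Reasoning

module Greedy (adj : Adjacency n) (I : ℕ → Subset n) where

  open Neighbourhood adj

  greedyStep : Subset n → ℕ → Subset n
  greedyStep S j = S ∪ I j ∖ N⁺ S

  greedy-extensive : ∀ S js → S ⊆ greedy adj I S js
  greedy-extensive S [] u Su = Su
  greedy-extensive S (j ∷ js) u Su =
    greedy-extensive (greedyStep S j) js u (cong (_∨ (I j ∖ N⁺ S) u) Su)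

  -- S is the set built by the greedy pass just before it processes I i.
  greedy-reaches : (P : Fin n → Set) → i < T →
    (∀ k → i < k → k < T → ∀ u → I k u ≡ true → P u) →
    ∀ S₀ → (∀ u → S₀ u ≡ true → P u) →
    ∃[ S ] (∀ u → S u ≡ true → P u) × greedyStep S i ⊆ greedy adj I S₀ (downFrom T)
  greedy-reaches {i} {suc T} P i<1+T later⊆P S₀ S₀⊆P with m<1+n⇒m<n∨m≡n i<1+T
  ... | inj₂ refl = S₀ , S₀⊆P , greedy-extensive (greedyStep S₀ i) (downFrom i)
  ... | inj₁ i<T = greedy-reaches P i<T (λ k i<k k<T → later⊆P k i<k (m<n⇒m<1+n k<T))
                                  (greedyStep S₀ T) step⊆P
    where
    step⊆P : ∀ u → greedyStep S₀ T u ≡ true → P u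
    step⊆P u S₀u∨new with S₀ u in S₀u
    ... | true = S₀⊆P u S₀u
    ... | false = later⊆P T i<T ≤-refl u (∧-conicalˡ _ _ S₀u∨new)

module GreedyBound (adj : Adjacency n) (w : Weight n) (I : ℕ → Subset n) where

  open Neighbourhood adj
  open WeightSequence adj w I
  open Greedy adj I

  weightOf-wts≤weightOf-wts'-finalSet : i < T → IsIndependent adj (I i) →
    (∀ k → 1 ≤ k → k < T → ∀ v → I k v ≡ true → 0 < W k v) →
    weightOf (W i) (I i) ≤ weightOf (W' i) (finalSet adj I T)
  weightOf-wts≤weightOf-wts'-finalSet {i} {T} i<T indep positive
    with greedy-reaches (λ u → 0 < W (suc i) u) i<T chosen-later-positive emptySet (λ _ ())
    where
    chosen-later-positive : ∀ k → i < k → k < T → ∀ u → I k u ≡ true → 0 < W (suc i) u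
    chosen-later-positive k i<k k<T u Iku =
      <-≤-trans (positive k (≤-trans (s≤s z≤n) i<k) k<T u Iku) (wts-antitone (≤⇒≤′ i<k) u)
  ... | S , S-positive , reached⊆final = begin
    weightOf (W i) (I i)                                   ≡⟨ weightOf-split (W i) (I i) (N⁺ S) ⟩
    weightOf (W i) (I i ∩ N⁺ S) + weightOf (W i) fresh     ≤⟨ +-monoˡ-≤ _ (weightOf-∩-N⁺ (W i) (I i) S) ⟩
    weightOf (removed i) S + weightOf (W i) fresh          ≡⟨ cong₂ _+_ removed≡W' W≡W' ⟩
    weightOf (W' i) S + weightOf (W' i) fresh              ≡⟨ weightOf-∪ (W' i) S fresh disjoint ⟨
    weightOf (W' i) (greedyStep S i)                       ≤⟨ weightOf-monoʳ (W' i) reached⊆final ⟩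
    weightOf (W' i) (finalSet adj I T)                     ∎
    where
    open ≤-Reasoning

    fresh : Subset n
    fresh = I i ∖ N⁺ S

    removed≡W' : weightOf (removed i) S ≡ weightOf (W' i) S
    removed≡W' = weightOf-congˡ _ _ S (λ u Su → sym (wts'-untruncated i u (S-positive u Su)))

    W≡W' : weightOf (W i) fresh ≡ weightOf (W' i) fresh
    W≡W' = weightOf-congˡ _ _ fresh (λ v fresh-v →
      sym (wts'-independent indep v (∧-conicalˡ _ _ fresh-v)))

    disjoint : ∀ u → S u ≡ true → fresh u ≡ false
    disjoint u Su rewrite ⊆-N⁺ S u Su = ∧-zeroʳ (I i u)

lemma4p4 : (n : ℕ) (adj : Adjacency n) → IsSimpleGraph adj →
    (w : Weight n) (T : ℕ) → 1 ≤ T →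
    (I : ℕ → Subset n) →
    (∀ i → i < T → IsIndependent adj (I i)) →
    (∀ i → 1 ≤ i → i < T → ∀ (v : Fin n) → I i v ≡ true → 0 < wts adj w I i v) →
    (weightOf w (finalSet adj I T) ≥ sumUpTo T (λ i → weightOf (wts adj w I i) (I i)))
    × (sumUpTo T (λ i → weightOf (wts adj w I i) (I i))
    ≡ sumUpTo T (λ i → weightOf (wts' adj w I i) (I i)))
lemma4p4 n adj _ w T _ I independent positive = greedy-bound , wts≡wts'
  where
  open WeightSequence adj w I
  open GreedyBound adj w I

  greedy-bound : sumUpTo T (λ i → weightOf (W i) (I i)) ≤ weightOf w (finalSet adj I T)
  greedy-bound = ≤-trans
    (sumUpTo-mono T (λ i i<T →
       weightOf-wts≤weightOf-wts'-finalSet i<T (independent i i<T) positive))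
    (sumUpTo-weightOf-wts'≤ T (finalSet adj I T))

  wts≡wts' : sumUpTo T (λ i → weightOf (W i) (I i)) ≡ sumUpTo T (λ i → weightOf (W' i) (I i))
  wts≡wts' = sumUpTo-cong T (λ i i<T →
    weightOf-congˡ (W i) (W' i) (I i) (λ v Iv → sym (wts'-independent (independent i i<T) v Iv)))
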